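{- Let $f$ and $g$ be distinct elements of a matroid $M$ such that $f$ is freer than $g$ in $M$ and $f$ is not a coloop of $M$. Then $\gamma'(f;M)\geq \gamma'(g;M)$.
   Context: For distinct elements $f,g$ of a matroid $M$, $f$ is freer than $g$ if $g$ is contained in the closure of every circuit of $M$ that contains $f$. For an element $e$ of $M$, $\gamma'(e;M)$ is the number of spanning circuits of $M$ containing $e$. -}

module Defs where

open import Data.Nat using (ℕ; zero; suc)
open import Data.Bool using (Bool; true; false; T; _∧_; _∨_; not)
open import Data.Fin using (Fin)
open import Data.Fin.Subset using (Subset; _∈_; _∉_; _⊆_; _⊂_; _∪_; ⁅_⁆; ⊤; ⊥; Nonempty; inside; outside)
open import Data.Vec using (Vec; []; _∷_; lookup)
open import Data.List using (List; []; _∷_; map; _++_; length; filter)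
open import Data.Bool.ListAction using (any; all)
open import Data.List.Membership.Propositional using () renaming (_∈_ to _∈ˡ_)
open import Data.Product using (_×_; ∃; _,_)
open import Relation.Nullary using (¬_)
open import Relation.Binary.PropositionalEquality using (_≡_)
open import Relation.Unary using (Pred)
import Relation.Unary as U
open import Function using (_∘_)

-- Finite matroids on the ground set E = Fin n, given by their circuits
-- (circuit axioms C1-C3 of Oxley).  The family of circuits is a Boolean
-- predicate on subsets (every family of subsets of a finite set is such).
record Matroid (n : ℕ) : Set where
  field
    isCircuit : Subset n → Bool
    C1 : ¬ T (isCircuit ⊥)
    C2 : ∀ C D → T (isCircuit C) → T (isCircuit D) → ¬ (D ⊂ C)
    C3 : ∀ C D (e : Fin n) → T (isCircuit C) → T (isCircuit D) → ¬ (C ≡ D)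
         → e ∈ C → e ∈ D
         → ∃ λ F → T (isCircuit F) × (F ⊆ ((C ∪ D) Data.Fin.Subset.- e))

open Matroid public

Circuit : ∀ {n} → Matroid n → Subset n → Set
Circuit M C = T (isCircuit M C)

allSubsets : (n : ℕ) → List (Subset n)
allSubsets zero = [] ∷ []
allSubsets (suc n) = map (outside ∷_) (allSubsets n) ++ map (inside ∷_) (allSubsets n)

_∈ᵇ_ : ∀ {n} → Fin n → Subset n → Bool
x ∈ᵇ p with lookup p x
... | inside = true
... | outside = false

_⊆ᵇ_ : ∀ {n} → Subset n → Subset n → Bool
[] ⊆ᵇ [] = true
(a ∷ p) ⊆ᵇ (b ∷ q) = (not a ∨ b) ∧ (p ⊆ᵇ q)

-- Closure (Oxley, Prop. 1.4.11): x ∈ cl(X) iff x ∈ X or there is a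
-- circuit C with x ∈ C ⊆ X ∪ {x}.
inClosureᵇ : ∀ {n} → Matroid n → Subset n → Fin n → Bool
inClosureᵇ {n} M X x =
  (x ∈ᵇ X) ∨ any (λ C → isCircuit M C ∧ (x ∈ᵇ C) ∧ (C ⊆ᵇ (X ∪ ⁅ x ⁆))) (allSubsets n)

InClosure : ∀ {n} → Matroid n → Subset n → Fin n → Set
InClosure M X x = T (inClosureᵇ M X x)

allFin : (n : ℕ) → List (Fin n)
allFin n = Data.List.allFin n

spanningᵇ : ∀ {n} → Matroid n → Subset n → Bool
spanningᵇ {n} M X = all (inClosureᵇ M X) (allFin n)

Freer : ∀ {n} → Matroid n → Fin n → Fin n → Set
Freer M f g = ¬ (f ≡ g) × (∀ C → Circuit M C → f ∈ C → InClosure M C g)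

Coloop : ∀ {n} → Matroid n → Fin n → Set
Coloop M e = ∀ C → Circuit M C → e ∉ C

γ′ : ∀ {n} → Matroid n → Fin n → ℕ
γ′ {n} M e = length (filter (λ C → T? (isCircuit M C ∧ spanningᵇ M C ∧ (e ∈ᵇ C))) (allSubsets n))
  where
  open import Relation.Nullary.Decidable using (Dec)
  T? : (b : Bool) → Dec (T b)
  T? = Data.Bool.T?

{-# OPTIONS --safe #-}
module Submission where

-- Swapping the coordinates f and g maps the spanning circuits through g injectively into
-- those through f. A spanning circuit C through g is fixed if it also contains f; otherwise
-- it goes to C' = C - g + f. This C' still spans, since C - g does. It is a circuit: spanning
-- gives a circuit F with f ∈ F ⊆ C', and if F missed some x ∈ C', then, as g ∈ cl(F) because
-- f is freer than g, circuit elimination would produce a circuit inside C - x, contradicting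
-- the minimality of C.

open import Defs
open import Data.Bool using (Bool; true; false; T; T?; _∧_; _∨_; not)
open import Data.Bool.Properties using (T-∧; T-∨)
open import Data.Bool.ListAction using (any; all)
open import Data.Empty using (⊥-elim)
open import Data.Fin using (Fin; _≟_)
open import Data.Fin.Permutation using (Permutation′; _⟨$⟩ʳ_; inverseˡ; inverseʳ; flip; transpose)
open import Data.Fin.Subset using (Subset; _∈_; _∉_; _⊆_; _∪_; _─_; _-_; ⁅_⁆; inside; outside)
open import Data.Fin.Subset.Properties
  using (_∈?_; ⊆-trans; ⊆-antisym; drop-∷-⊆; p⊆p∪q; p─q⊆p; x∈p∪q⁺; x∈p∪q⁻; x∈⁅x⁆; x∈⁅y⁆⇒x≡y; x∉⁅y⁆⇒x≢y; x∈p∧x≢y⇒x∈p-y)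
open import Data.List using ([]; _∷_; map; length; filter)
open import Data.List.Membership.Propositional using (lose) renaming (_∈_ to _∈ˡ_)
open import Data.List.Membership.Propositional.Properties using (∈-map⁺; ∈-map⁻; ∈-++⁺ˡ; ∈-++⁺ʳ; ∈-allFin)
open import Data.List.Membership.Propositional.Properties.WithK using (unique∧set⇒bag)
open import Data.List.Relation.Binary.BagAndSetEquality using (∼bag⇒↭)
open import Data.List.Relation.Binary.Permutation.Propositional using (_↭_)
open import Data.List.Relation.Binary.Permutation.Propositional.Properties using (filter-↭; ↭-length)
import Data.List.Relation.Unary.All as All
open import Data.List.Relation.Unary.All.Properties using (all⁺; all⁻)
import Data.List.Relation.Unary.AllPairs as AllPairs
import Data.List.Relation.Unary.Any as Any
open import Data.List.Relation.Unary.Any.Properties using (any⁺; any⁻)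
open import Data.List.Relation.Unary.Unique.Propositional using (Unique)
import Data.List.Relation.Unary.Unique.Propositional.Properties as Unique
open import Data.Nat using (ℕ; zero; suc; _≤_; _≥_; z≤n; s≤s)
open import Data.Nat.Properties using (m≤n⇒m≤1+n; module ≤-Reasoning)
open import Data.Product using (_×_; _,_; ∃; proj₁; proj₂; map₂)
open import Data.Product.Function.NonDependent.Propositional using (_×-⇔_)
open import Data.Sum using (_⊎_; inj₁; inj₂; [_,_])
import Data.Sum as Sum
open import Data.Sum.Function.Propositional using (_⊎-⇔_)
open import Data.Unit using (tt)
open import Data.Vec using ([]; _∷_; lookup; tabulate; here; there)
open import Data.Vec.Properties using ([]=⇒lookup; lookup⇒[]=; lookup∘tabulate; tabulate∘lookup; tabulate-cong; ∷-injectiveʳ)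
open import Function using (_∘_; id)
open import Function.Bundles using (_⇔_; mk⇔; Equivalence)
open import Function.Properties.Equivalence using () renaming (refl to ⇔-refl; trans to ⇔-trans)
open import Relation.Nullary using (¬_; yes; no)
open import Relation.Nullary.Decidable using (dec-true; dec-false)
open import Relation.Binary.PropositionalEquality using (_≡_; _≢_; refl; sym; trans; cong; subst; module ≡-Reasoning)

open Equivalence using (to; from)

private
  variable
    n : ℕ
    a b x y : Fin n
    p q : Subset n

x∈p─q⇒x∉q : ∀ (p q : Subset n) → x ∈ p ─ q → x ∉ q
x∈p─q⇒x∉q (_ ∷ p) (inside  ∷ q) (there x∈p─q) (there x∈q) = x∈p─q⇒x∉q p q x∈p─q x∈q
x∈p─q⇒x∉q (_ ∷ p) (outside ∷ q) (there x∈p─q) (there x∈q) = x∈p─q⇒x∉q p q x∈p─q x∈q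

x∈p-y⁻ : x ∈ p - y → x ∈ p × x ≢ y
x∈p-y⁻ {p = p} {y = y} x∈p-y = p─q⊆p p ⁅ y ⁆ x∈p-y , x∉⁅y⁆⇒x≢y (x∈p─q⇒x∉q p ⁅ y ⁆ x∈p-y)

x∈p∪⁅y⁆⁻ : x ∈ p ∪ ⁅ y ⁆ → x ∈ p ⊎ x ≡ y
x∈p∪⁅y⁆⁻ {p = p} {y = y} = Sum.map₂ (x∈⁅y⁆⇒x≡y y) ∘ x∈p∪q⁻ p ⁅ y ⁆

y∈p∪⁅y⁆ : y ∈ p ∪ ⁅ y ⁆
y∈p∪⁅y⁆ {y = y} = x∈p∪q⁺ (inj₂ (x∈⁅x⁆ y))

x∈p∪⁅b⁆⇒x∈p-a∪⁅b⁆ : x ∈ p ∪ ⁅ b ⁆ → x ≢ a → x ∈ (p - a) ∪ ⁅ b ⁆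
x∈p∪⁅b⁆⇒x∈p-a∪⁅b⁆ x∈p∪⁅b⁆ x≢a with x∈p∪⁅y⁆⁻ x∈p∪⁅b⁆
... | inj₁ x∈p = x∈p∪q⁺ (inj₁ (x∈p∧x≢y⇒x∈p-y x∈p x≢a))
... | inj₂ refl = y∈p∪⁅y⁆

p⊆p-a∪⁅a⁆ : p ⊆ (p - a) ∪ ⁅ a ⁆
p⊆p-a∪⁅a⁆ {a = a} {x} x∈p with x ≟ a
... | yes refl = y∈p∪⁅y⁆
... | no x≢a = x∈p∪q⁺ (inj₁ (x∈p∧x≢y⇒x∈p-y x∈p x≢a))

∪-monoˡ-⊆ : ∀ (r : Subset n) → p ⊆ q → p ∪ r ⊆ q ∪ r
∪-monoˡ-⊆ {p = p} r p⊆q = x∈p∪q⁺ ∘ Sum.map₁ p⊆q ∘ x∈p∪q⁻ p r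

∈ᵇ⇔∈ : T (x ∈ᵇ p) ⇔ x ∈ p
∈ᵇ⇔∈ {x = x} {p} with lookup p x in eq
... | true  = mk⇔ (λ _ → lookup⇒[]= x p eq) (λ _ → tt)
... | false = mk⇔ (λ ()) (λ x∈p → true≢false (trans (sym ([]=⇒lookup x∈p)) eq))
  where
  true≢false : true ≢ false
  true≢false ()

⊆ᵇ⇒⊆ : ∀ (p q : Subset n) → T (p ⊆ᵇ q) → p ⊆ q
⊆ᵇ⇒⊆ (inside ∷ p) (inside  ∷ q) _  here        = here
⊆ᵇ⇒⊆ (inside ∷ p) (outside ∷ q) () here
⊆ᵇ⇒⊆ (s      ∷ p) (t       ∷ q) le (there x∈p) = there (⊆ᵇ⇒⊆ p q (proj₂ (to (T-∧ {not s ∨ t}) le)) x∈p)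

⊆⇒⊆ᵇ : ∀ (p q : Subset n) → p ⊆ q → T (p ⊆ᵇ q)
⊆⇒⊆ᵇ []            []            _   = tt
⊆⇒⊆ᵇ (inside  ∷ p) (inside  ∷ q) p⊆q = ⊆⇒⊆ᵇ p q (drop-∷-⊆ p⊆q)
⊆⇒⊆ᵇ (inside  ∷ p) (outside ∷ q) p⊆q with () ← p⊆q here
⊆⇒⊆ᵇ (outside ∷ p) (_       ∷ q) p⊆q = ⊆⇒⊆ᵇ p q (drop-∷-⊆ p⊆q)

⊆ᵇ⇔⊆ : T (p ⊆ᵇ q) ⇔ p ⊆ q
⊆ᵇ⇔⊆ {p = p} {q} = mk⇔ (⊆ᵇ⇒⊆ p q) (⊆⇒⊆ᵇ p q)

∈-allSubsets : ∀ (p : Subset n) → p ∈ˡ allSubsets n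
∈-allSubsets []            = Any.here refl
∈-allSubsets (outside ∷ p) = ∈-++⁺ˡ (∈-map⁺ (outside ∷_) (∈-allSubsets p))
∈-allSubsets {n = suc n} (inside ∷ p) = ∈-++⁺ʳ (map (outside ∷_) (allSubsets n)) (∈-map⁺ (inside ∷_) (∈-allSubsets p))

allSubsets-unique : ∀ n → Unique (allSubsets n)
allSubsets-unique zero    = All.[] AllPairs.∷ AllPairs.[]
allSubsets-unique (suc n) =
  Unique.++⁺ (Unique.map⁺ ∷-injectiveʳ (allSubsets-unique n)) (Unique.map⁺ ∷-injectiveʳ (allSubsets-unique n)) disjoint
  where
  disjoint : ∀ {p} → ¬ (p ∈ˡ map (outside ∷_) (allSubsets n) × p ∈ˡ map (inside ∷_) (allSubsets n))
  disjoint (p∈outside , p∈inside) with ∈-map⁻ (outside ∷_) p∈outside | ∈-map⁻ (inside ∷_) p∈inside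
  ... | _ , _ , refl | _ , _ , ()

any-allSubsets⇔ : ∀ {P : Subset n → Bool} → T (any P (allSubsets n)) ⇔ ∃ (T ∘ P)
any-allSubsets⇔ {n} {P} = mk⇔ (Any.satisfied ∘ any⁻ P (allSubsets n)) (λ (p , Pp) → any⁺ P (lose (∈-allSubsets p) Pp))

all-allFin⇔ : ∀ {P : Fin n → Bool} → T (all P (allFin n)) ⇔ (∀ x → T (P x))
all-allFin⇔ {n} {P} = mk⇔
  (λ t x → All.lookup (all⁺ P (allFin n) t) (∈-allFin x))
  (λ h → all⁻ P {allFin n} (All.tabulate (λ {x} _ → h x)))

rename : Permutation′ n → Subset n → Subset n
rename π p = tabulate (λ x → lookup p (π ⟨$⟩ʳ x))

∈-rename⇔ : ∀ (π : Permutation′ n) → x ∈ rename π p ⇔ π ⟨$⟩ʳ x ∈ p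
∈-rename⇔ {x = x} {p} π = mk⇔
  (λ x∈πp → lookup⇒[]= _ p (trans (sym (lookup∘tabulate _ x)) ([]=⇒lookup x∈πp)))
  (λ πx∈p → lookup⇒[]= x _ (trans (lookup∘tabulate _ x) ([]=⇒lookup πx∈p)))

rename-inverse : ∀ (π ρ : Permutation′ n) → (∀ x → π ⟨$⟩ʳ (ρ ⟨$⟩ʳ x) ≡ x) → ∀ p → rename ρ (rename π p) ≡ p
rename-inverse π ρ π∘ρ≡id p = begin
  rename ρ (rename π p)                          ≡⟨ tabulate-cong (λ x → lookup∘tabulate _ (ρ ⟨$⟩ʳ x)) ⟩
  tabulate (λ x → lookup p (π ⟨$⟩ʳ (ρ ⟨$⟩ʳ x)))  ≡⟨ tabulate-cong (cong (lookup p) ∘ π∘ρ≡id) ⟩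
  tabulate (lookup p)                            ≡⟨ tabulate∘lookup p ⟩
  p                                              ∎
  where open ≡-Reasoning

rename-injective : ∀ (π : Permutation′ n) → rename π p ≡ rename π q → p ≡ q
rename-injective {p = p} {q} π πp≡πq = begin
  p                              ≡⟨ rename-inverse π (flip π) (λ _ → inverseʳ π) p ⟨
  rename (flip π) (rename π p)   ≡⟨ cong (rename (flip π)) πp≡πq ⟩
  rename (flip π) (rename π q)   ≡⟨ rename-inverse π (flip π) (λ _ → inverseʳ π) q ⟩
  q                              ∎
  where open ≡-Reasoning

map-rename-allSubsets↭ : ∀ (π : Permutation′ n) → map (rename π) (allSubsets n) ↭ allSubsets n
map-rename-allSubsets↭ {n} π = ∼bag⇒↭ (unique∧set⇒bag
  (Unique.map⁺ (rename-injective π) (allSubsets-unique n)) (allSubsets-unique n)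
  (λ {p} → mk⇔ (λ _ → ∈-allSubsets p) (λ _ → subst (_∈ˡ map (rename π) (allSubsets n))
    (rename-inverse (flip π) π (λ _ → inverseˡ π) p) (∈-map⁺ (rename π) (∈-allSubsets (rename (flip π) p))))))

length-filter-map-≤ : ∀ {A B : Set} (P : A → Bool) (Q : B → Bool) (φ : A → B) → (∀ x → T (P x) → T (Q (φ x))) →
  ∀ xs → length (filter (T? ∘ P) xs) ≤ length (filter (T? ∘ Q) (map φ xs))
length-filter-map-≤ P Q φ P⇒Qφ []       = z≤n
length-filter-map-≤ P Q φ P⇒Qφ (x ∷ xs) with ih ← length-filter-map-≤ P Q φ P⇒Qφ xs | P x | Q (φ x) | P⇒Qφ x
... | true  | true  | _          = s≤s ih
... | true  | false | impossible = ⊥-elim (impossible tt)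
... | false | true  | _          = m≤n⇒m≤1+n ih
... | false | false | _          = ih

count-≤-rename : ∀ (π : Permutation′ n) (P Q : Subset n → Bool) → (∀ p → T (P p) → T (Q (rename π p))) →
  length (filter (T? ∘ P) (allSubsets n)) ≤ length (filter (T? ∘ Q) (allSubsets n))
count-≤-rename {n} π P Q P⇒Q∘π = begin
  length (filter (T? ∘ P) (allSubsets n))                   ≤⟨ length-filter-map-≤ P Q (rename π) P⇒Q∘π (allSubsets n) ⟩
  length (filter (T? ∘ Q) (map (rename π) (allSubsets n)))  ≡⟨ ↭-length (filter-↭ (T? ∘ Q) (map-rename-allSubsets↭ π)) ⟩
  length (filter (T? ∘ Q) (allSubsets n))                   ∎
  where open ≤-Reasoning

transpose-matchˡ : ∀ (a b : Fin n) → transpose a b ⟨$⟩ʳ a ≡ b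
transpose-matchˡ a b rewrite dec-true (a ≟ a) refl = refl

transpose-matchʳ : ∀ (a b : Fin n) → transpose a b ⟨$⟩ʳ b ≡ a
transpose-matchʳ a b with b ≟ a
... | yes b≡a = b≡a
... | no  _   rewrite dec-true (b ≟ b) refl = refl

transpose-fix : x ≢ a → x ≢ b → transpose a b ⟨$⟩ʳ x ≡ x
transpose-fix {x = x} {a} {b} x≢a x≢b rewrite dec-false (x ≟ a) x≢a | dec-false (x ≟ b) x≢b = refl

data TranspositionView (a b : Fin n) : Fin n → Set where
  at-left  : TranspositionView a b a
  at-right : TranspositionView a b b
  away     : ∀ {x} → x ≢ a → x ≢ b → TranspositionView a b x

transpositionView : ∀ (a b x : Fin n) → TranspositionView a b x
transpositionView a b x with x ≟ a | x ≟ b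
... | yes refl | _        = at-left
... | no  _    | yes refl = at-right
... | no  x≢a  | no  x≢b  = away x≢a x≢b

rename-transpose-fix : a ∈ p → b ∈ p → rename (transpose a b) p ≡ p
rename-transpose-fix {a = a} {p} {b} a∈p b∈p = trans (tabulate-cong lookup-transpose) (tabulate∘lookup p)
  where
  lookup-transpose : ∀ x → lookup p (transpose a b ⟨$⟩ʳ x) ≡ lookup p x
  lookup-transpose x with transpositionView a b x
  ... | at-left      = trans (cong (lookup p) (transpose-matchˡ a b)) (trans ([]=⇒lookup b∈p) (sym ([]=⇒lookup a∈p)))
  ... | at-right     = trans (cong (lookup p) (transpose-matchʳ a b)) (trans ([]=⇒lookup a∈p) (sym ([]=⇒lookup b∈p)))
  ... | away x≢a x≢b = cong (lookup p) (transpose-fix x≢a x≢b)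

rename-transpose-exchange : b ∈ p → a ∉ p → rename (transpose a b) p ≡ (p - b) ∪ ⁅ a ⁆
rename-transpose-exchange {b = b} {p} {a} b∈p a∉p = ⊆-antisym ⊆-exchange exchange-⊆
  where
  ⊆-exchange : rename (transpose a b) p ⊆ (p - b) ∪ ⁅ a ⁆
  ⊆-exchange {x} x∈τp with transpositionView a b x | to (∈-rename⇔ (transpose a b)) x∈τp
  ... | at-left      | _    = y∈p∪⁅y⁆
  ... | at-right     | τb∈p = ⊥-elim (a∉p (subst (_∈ p) (transpose-matchʳ a b) τb∈p))
  ... | away x≢a x≢b | τx∈p = x∈p∪q⁺ (inj₁ (x∈p∧x≢y⇒x∈p-y (subst (_∈ p) (transpose-fix x≢a x≢b) τx∈p) x≢b))
  exchange-⊆ : (p - b) ∪ ⁅ a ⁆ ⊆ rename (transpose a b) p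
  exchange-⊆ {x} x∈p-b∪⁅a⁆ = from (∈-rename⇔ (transpose a b)) (τx∈p (x∈p∪⁅y⁆⁻ x∈p-b∪⁅a⁆))
    where
    τx∈p : x ∈ p - b ⊎ x ≡ a → transpose a b ⟨$⟩ʳ x ∈ p
    τx∈p (inj₂ refl)  = subst (_∈ p) (sym (transpose-matchˡ a b)) b∈p
    τx∈p (inj₁ x∈p-b) = let x∈p , x≢b = x∈p-y⁻ x∈p-b in
      subst (_∈ p) (sym (transpose-fix (λ { refl → a∉p x∈p }) x≢b)) x∈p

module _ (M : Matroid n) where

  Closure : Subset n → Fin n → Set
  Closure X y = y ∈ X ⊎ ∃ λ C → Circuit M C × y ∈ C × C ⊆ X ∪ ⁅ y ⁆

  Spans : Subset n → Set
  Spans X = ∀ y → Closure X y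

  InClosure⇔Closure : ∀ {X y} → InClosure M X y ⇔ Closure X y
  InClosure⇔Closure = ⇔-trans T-∨ (∈ᵇ⇔∈ ⊎-⇔ ⇔-trans any-allSubsets⇔ (mk⇔ (map₂ (to witness⇔)) (map₂ (from witness⇔))))
    where
    witness⇔ : ∀ {X y C} → T (isCircuit M C ∧ (y ∈ᵇ C) ∧ (C ⊆ᵇ (X ∪ ⁅ y ⁆))) ⇔ (Circuit M C × y ∈ C × C ⊆ X ∪ ⁅ y ⁆)
    witness⇔ = ⇔-trans T-∧ (⇔-refl ×-⇔ ⇔-trans T-∧ (∈ᵇ⇔∈ ×-⇔ ⊆ᵇ⇔⊆))

  spanningCircuitThroughᵇ : Fin n → Subset n → Bool
  spanningCircuitThroughᵇ e C = isCircuit M C ∧ spanningᵇ M C ∧ (e ∈ᵇ C)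

  spanningCircuitThroughᵇ⇔ : ∀ {e C} → T (spanningCircuitThroughᵇ e C) ⇔ (Circuit M C × Spans C × e ∈ C)
  spanningCircuitThroughᵇ⇔ = ⇔-trans T-∧ (⇔-refl ×-⇔ ⇔-trans T-∧ (spans⇔ ×-⇔ ∈ᵇ⇔∈))
    where
    spans⇔ : ∀ {X} → T (spanningᵇ M X) ⇔ Spans X
    spans⇔ = ⇔-trans all-allFin⇔ (mk⇔ (λ h y → to InClosure⇔Closure (h y)) (λ h y → from InClosure⇔Closure (h y)))

  circuit-minimal : ∀ {C D} → Circuit M C → Circuit M D → D ⊆ C → C ⊆ D
  circuit-minimal {C} {D} cC cD D⊆C {x} x∈C with x ∈? D
  ... | yes x∈D = x∈D
  ... | no  x∉D = ⊥-elim (C2 M C D cC cD (D⊆C , x , x∈C , x∉D))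

  Closure-mono : ∀ {X Y y} → X ⊆ Y → Closure X y → Closure Y y
  Closure-mono X⊆Y (inj₁ y∈X)                 = inj₁ (X⊆Y y∈X)
  Closure-mono X⊆Y (inj₂ (C , cC , y∈C , C⊆)) = inj₂ (C , cC , y∈C , ∪-monoˡ-⊆ _ X⊆Y ∘ C⊆)

  circuit-⊆-exchange : ∀ {C a b} → Circuit M C → a ∈ C → b ∉ C → Closure C b →
                       ∃ λ F → Circuit M F × F ⊆ (C - a) ∪ ⁅ b ⁆
  circuit-⊆-exchange _ _ b∉C (inj₁ b∈C) = ⊥-elim (b∉C b∈C)
  circuit-⊆-exchange {C} {a} {b} cC a∈C b∉C (inj₂ (D , cD , b∈D , D⊆C∪⁅b⁆)) with a ∈? D
  ... | no a∉D = D , cD , λ z∈D → x∈p∪⁅b⁆⇒x∈p-a∪⁅b⁆ (D⊆C∪⁅b⁆ z∈D) (λ { refl → a∉D z∈D })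
  ... | yes a∈D with C3 M C D a cC cD (λ { refl → b∉C b∈D }) a∈C a∈D
  ... | F , cF , F⊆C∪D-a = F , cF , λ z∈F →
    let z∈C∪D , z≢a = x∈p-y⁻ (F⊆C∪D-a z∈F) in
    x∈p∪⁅b⁆⇒x∈p-a∪⁅b⁆ ([ p⊆p∪q ⁅ b ⁆ , D⊆C∪⁅b⁆ ] (x∈p∪q⁻ C D z∈C∪D)) z≢a

  circuit-exchange : ∀ {C a b} → Circuit M C → a ∈ C → b ∉ C → Closure C b →
                     ∃ λ F → Circuit M F × b ∈ F × F ⊆ (C - a) ∪ ⁅ b ⁆
  circuit-exchange {C} {a} {b} cC a∈C b∉C b∈clC with circuit-⊆-exchange cC a∈C b∉C b∈clC
  ... | F , cF , F⊆C-a∪⁅b⁆ with b ∈? F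
  ... | yes b∈F = F , cF , b∈F , F⊆C-a∪⁅b⁆
  ... | no  b∉F = ⊥-elim (proj₂ (x∈p-y⁻ a∈C-a) refl)
    where
    F⊆C-a : F ⊆ C - a
    F⊆C-a z∈F = [ id , (λ { refl → ⊥-elim (b∉F z∈F) }) ] (x∈p∪⁅y⁆⁻ (F⊆C-a∪⁅b⁆ z∈F))
    a∈C-a : a ∈ C - a
    a∈C-a = F⊆C-a (circuit-minimal cC cF (⊆-trans F⊆C-a (p─q⊆p C ⁅ a ⁆)) a∈C)

  circuit-minus-spans : ∀ {C a} → Circuit M C → Spans C → a ∈ C → Spans (C - a)
  circuit-minus-spans {C} {a} cC spC a∈C y with y ∈? C - a | y ≟ a
  ... | yes y∈C-a | _        = inj₁ y∈C-a
  ... | no  _     | yes refl = inj₂ (C , cC , a∈C , p⊆p-a∪⁅a⁆)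
  ... | no  y∉C-a | no  y≢a  = inj₂ (circuit-exchange cC a∈C (λ y∈C → y∉C-a (x∈p∧x≢y⇒x∈p-y y∈C y≢a)) (spC y))

  freer-exchange-circuit : ∀ {C f g} → Freer M f g → Circuit M C → Spans C → g ∈ C → f ∉ C →
                           Circuit M ((C - g) ∪ ⁅ f ⁆)
  freer-exchange-circuit {C} {f} {g} (_ , g∈cl) cC spC g∈C f∉C with circuit-exchange cC g∈C f∉C (spC f)
  ... | F , cF , f∈F , F⊆C′ = subst (Circuit M) (⊆-antisym F⊆C′ C′⊆F) cF
    where
    g∉F : g ∉ F
    g∉F g∈F with x∈p∪⁅y⁆⁻ (F⊆C′ g∈F)
    ... | inj₁ g∈C-g = proj₂ (x∈p-y⁻ g∈C-g) refl
    ... | inj₂ refl  = f∉C g∈C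
    F-f∪⁅g⁆⊆C : (F - f) ∪ ⁅ g ⁆ ⊆ C
    F-f∪⁅g⁆⊆C z∈ with x∈p∪⁅y⁆⁻ z∈
    ... | inj₂ refl = g∈C
    ... | inj₁ z∈F-f with x∈p-y⁻ z∈F-f
    ... | z∈F , z≢f = [ proj₁ ∘ x∈p-y⁻ , ⊥-elim ∘ z≢f ] (x∈p∪⁅y⁆⁻ (F⊆C′ z∈F))
    C′⊆F : (C - g) ∪ ⁅ f ⁆ ⊆ F
    C′⊆F {x} x∈C′ with x∈p∪⁅y⁆⁻ x∈C′
    ... | inj₂ refl = f∈F
    ... | inj₁ x∈C-g with x ∈? F
    ... | yes x∈F = x∈F
    ... | no  x∉F with circuit-exchange cF f∈F g∉F (to InClosure⇔Closure (g∈cl F cF f∈F))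
    ... | G , cG , _ , G⊆F-f∪⁅g⁆ = ⊥-elim (x∉G (circuit-minimal cC cG (⊆-trans G⊆F-f∪⁅g⁆ F-f∪⁅g⁆⊆C) (proj₁ (x∈p-y⁻ x∈C-g))))
      where
      x∉G : x ∉ G
      x∉G x∈G = [ x∉F ∘ proj₁ ∘ x∈p-y⁻ , proj₂ (x∈p-y⁻ x∈C-g) ] (x∈p∪⁅y⁆⁻ (G⊆F-f∪⁅g⁆ x∈G))

  transpose-spanningCircuit : ∀ {C f g} → Freer M f g → Circuit M C → Spans C → g ∈ C →
    let C′ = rename (transpose f g) C in Circuit M C′ × Spans C′ × f ∈ C′
  transpose-spanningCircuit {C} {f} {g} f-freer-g cC spC g∈C with f ∈? C
  ... | yes f∈C = subst (λ X → Circuit M X × Spans X × f ∈ X) (sym (rename-transpose-fix f∈C g∈C)) (cC , spC , f∈C)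
  ... | no  f∉C = subst (λ X → Circuit M X × Spans X × f ∈ X) (sym (rename-transpose-exchange g∈C f∉C))
    ( freer-exchange-circuit f-freer-g cC spC g∈C f∉C
    , (λ y → Closure-mono (p⊆p∪q ⁅ f ⁆) (circuit-minus-spans cC spC g∈C y))
    , y∈p∪⁅y⁆ )

corollary9 : {n : ℕ} (M : Matroid n) (f g : Fin n)
    → ¬ (f ≡ g) → Freer M f g → ¬ Coloop M f
    → γ′ M f ≥ γ′ M g
corollary9 M f g _ f-freer-g _ =
  count-≤-rename (transpose f g) (spanningCircuitThroughᵇ M g) (spanningCircuitThroughᵇ M f) λ C C∋g →
    let cC , spC , g∈C = to (spanningCircuitThroughᵇ⇔ M) C∋g in
    from (spanningCircuitThroughᵇ⇔ M) (transpose-spanningCircuit M f-freer-g cC spC g∈C)
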